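{- Let $C$ and $C'$ be two simple Chip Firing Games on the same vertex set $\{v_1,\ldots,v_n,\bot\}$, where $\bot$ is the unique sink of both support graphs. Suppose that for each $i\in\{1,\ldots,n\}$ the family $X_i$ of shot-sets of the minimal reachable configurations in which $v_i$ can be fired is the same in $C$ and in $C'$. Then the configuration spaces of $C$ and $C'$ are isomorphic posets. In other words, the configuration space of $C$ is completely determined by $\{v_1,\ldots,v_n\}$ and $\{X_1,\ldots,X_n\}$.
   Context: A Chip Firing Game (CFG) is played on a finite directed multigraph $G=(V,E)$, the support graph, starting from an initial configuration $\sigma_0:V\to\mathbb{N}$ giving a number of chips on each vertex. A vertex $v$ with at least one outgoing edge and at least $d^+(v)$ chips (its outdegree) may be fired: one chip is sent along each outgoing edge of $v$ to the other endpoint. A sink is a vertex with no outgoing edges, and it is never fired. The configuration space of the game is the set of configurations reachable from $\sigma_0$ by sequences of firings, ordered by $\sigma\le\sigma'$ iff $\sigma'$ is reachable from $\sigma$. The game is convergent if it reaches a final configuration in which no firing is possible. An execution is a firing sequence from the initial configuration to the final one. A convergent CFG is simple if each vertex is fired at most once during an execution. Standing assumptions: the support graph has exactly one sink $\bot$ and no loops, and every vertex other than $\bot$ is fired during an execution. In a simple CFG, two firing sequences from the same configuration that reach the same configuration fire the same set of vertices. The shot-set $\mathrm{sh}(\sigma)$ of a reachable configuration $\sigma$ is therefore well defined as the set of vertices fired to reach $\sigma$ from $\sigma_0$. A reachable configuration in which $v_i$ can be fired is minimal if its shot-set is minimal for inclusion among such configurations. -}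

module Defs where

open import Data.Nat using (ℕ; zero; suc; _+_; _∸_; _≤_)
open import Data.Fin using (Fin; zero; suc; _≟_)
open import Data.Vec using (Vec; lookup; tabulate; sum)
open import Data.List using (List; []; _∷_)
open import Data.List.Membership.Propositional using (_∈_)
open import Data.List.Relation.Unary.Unique.Propositional using (Unique)
open import Data.Product using (Σ; ∃; ∃-syntax; _×_; _,_; proj₁)
open import Data.Bool using (if_then_else_)
open import Relation.Nullary using (¬_)
open import Relation.Nullary.Decidable using (⌊_⌋)
open import Relation.Binary.PropositionalEquality using (_≡_)
open import Function.Bundles using (_⇔_)

-- Vertex set {⊥, v₁, …, vₙ} encoded as Fin (suc n):
-- the sink ⊥ is 'zero' and v_i is 'suc i' (i : Fin n).
Vertex : ℕ → Set
Vertex n = Fin (suc n)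

sink : ∀ {n} → Vertex n
sink = zero

-- A finite directed multigraph on Vertex n, given by edge multiplicities:
-- mult v w = number of edges from v to w.
Multigraph : ℕ → Set
Multigraph n = Vertex n → Vertex n → ℕ

outdeg : ∀ {n} → Multigraph n → Vertex n → ℕ
outdeg G v = sum (tabulate (G v))

Config : ℕ → Set
Config n = Vec ℕ (suc n)

CanFire : ∀ {n} → Multigraph n → Config n → Vertex n → Set
CanFire G σ v = (1 ≤ outdeg G v) × (outdeg G v ≤ lookup σ v)

fire : ∀ {n} → Multigraph n → Config n → Vertex n → Config n
fire G σ v = tabulate λ w →
  (lookup σ w + G v w) ∸ (if ⌊ w ≟ v ⌋ then outdeg G v else 0)

data Exec {n} (G : Multigraph n) : Config n → List (Vertex n) → Config n → Set where
  done : ∀ {σ} → Exec G σ [] σ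
  step : ∀ {σ v vs σ'} → CanFire G σ v → Exec G (fire G σ v) vs σ' → Exec G σ (v ∷ vs) σ'

Reach : ∀ {n} → Multigraph n → Config n → Config n → Set
Reach G σ σ' = ∃[ vs ] Exec G σ vs σ'

Final : ∀ {n} → Multigraph n → Config n → Set
Final G σ = ∀ v → ¬ CanFire G σ v

record CFG (n : ℕ) : Set where
  field
    graph   : Multigraph n
    initial : Config n

open CFG public

record IsSimpleCFG {n} (C : CFG n) : Set where
  field
    noLoops    : ∀ v → graph C v v ≡ 0
    sinkIsSink : outdeg (graph C) sink ≡ 0
    uniqueSink : ∀ (i : Fin n) → 1 ≤ outdeg (graph C) (suc i)
    convergent : ∃[ σ ] Reach (graph C) (initial C) σ × Final (graph C) σ
    simple     : ∀ vs σ → Exec (graph C) (initial C) vs σ → Final (graph C) σ → Unique vs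
    allFired   : ∀ vs σ → Exec (graph C) (initial C) vs σ → Final (graph C) σ →
                 ∀ (i : Fin n) → suc i ∈ vs

VSet : ℕ → Set₁
VSet n = Vertex n → Set

_⊆_ : ∀ {n} → VSet n → VSet n → Set
S ⊆ T = ∀ v → S v → T v

ShotSet : ∀ {n} → CFG n → Config n → VSet n → Set
ShotSet C σ S = ∃[ vs ] Exec (graph C) (initial C) vs σ × (∀ v → (v ∈ vs) ⇔ S v)

InX : ∀ {n} → CFG n → Fin n → VSet n → Set₁
InX C i S =
  (∃[ σ ] ShotSet C σ S × CanFire (graph C) σ (suc i)) ×
  (∀ σ' S' → ShotSet C σ' S' → CanFire (graph C) σ' (suc i) → S' ⊆ S → S ⊆ S')

ConfigSpace : ∀ {n} → CFG n → Set
ConfigSpace C = Σ (Config _) (Reach (graph C) (initial C))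

_≤⟨_⟩_ : ∀ {n} (x : Config n) (C : CFG n) (y : Config n) → Set
x ≤⟨ C ⟩ y = Reach (graph C) x y

record OrderIso {n} (C C' : CFG n) : Set where
  field
    to      : ConfigSpace C → ConfigSpace C'
    from    : ConfigSpace C' → ConfigSpace C
    from∘to : ∀ x → proj₁ (from (to x)) ≡ proj₁ x
    to∘from : ∀ y → proj₁ (to (from y)) ≡ proj₁ y
    mono    : ∀ x y → (proj₁ x ≤⟨ C ⟩ proj₁ y) ⇔ (proj₁ (to x) ≤⟨ C' ⟩ proj₁ (to y))

-- In a simple game the configuration reached by a firing sequence depends only
-- on the set of vertices fired, and two sequences reaching the same configuration
-- fire the same set.  So it suffices that every sequence legal in C is legal in
-- C′ and conversely.  If vᵢ is fireable after shooting the set T in C, some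
-- minimal shot-set S ⊆ T lies in Xᵢ, hence in X′ᵢ; in C′ the vertex vᵢ is fireable
-- after S, and since vᵢ ∉ T it only gains chips while the rest of T is fired, so
-- it is fireable after T in C′ as well.  Sending a configuration to the one
-- reached by the same sequence in the other game is then an order isomorphism.

module Submission where

open import Defs hiding (_≤⟨_⟩_)
open import Data.Empty using (⊥-elim)
open import Data.Fin using (Fin; zero; suc; _≟_)
open import Data.List using (List; []; _∷_; _++_; map; length)
open import Data.List.Properties using (map-++; length-++-≤ˡ)
open import Data.List.Membership.Propositional using (_∈_; _∉_; find)
open import Data.List.Membership.Propositional.Properties using (∈-∃++; ∈-++⁻)
open import Data.List.Membership.Propositional.Properties.WithK using (unique∧set⇒bag)
open import Data.List.Relation.Binary.BagAndSetEquality using (∼bag⇒↭)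
open import Data.List.Relation.Binary.Disjoint.Propositional using (Disjoint)
open import Data.List.Relation.Binary.Permutation.Propositional using (_↭_; ↭-refl; ↭-prep; ↭-swap; ↭-trans)
open import Data.List.Relation.Binary.Permutation.Propositional.Properties using (shift; map⁺; ∈-resp-↭; ↭-length)
open import Data.List.Relation.Binary.Subset.Propositional using () renaming (_⊆_ to _⊆ₗ_)
open import Data.List.Relation.Unary.All as All using (All; []; _∷_; all?)
open import Data.List.Relation.Unary.All.Properties using (++⁻ˡ; ++⁻ʳ; ¬All⇒Any¬; ¬Any⇒All¬)
open import Data.List.Relation.Unary.Any using (here; there)
open import Data.List.Relation.Unary.Unique.Propositional using (Unique; []; _∷_)
open import Data.Nat using (ℕ; _+_; _∸_; _≤_; _<_; _≤?_; z≤n)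
open import Data.Nat.Induction using (<-wellFounded)
open import Data.Nat.ListAction using (sum)
open import Data.Nat.ListAction.Properties using (sum-++; sum-↭)
open import Data.Nat.Properties using (+-commutativeSemigroup; +-assoc; +-identityʳ; +-cancelʳ-≡; +-monoʳ-≤; m≤m+n; m∸n+n≡m; ≤-trans; ≤-reflexive; module ≤-Reasoning)
open import Algebra.Properties.CommutativeSemigroup +-commutativeSemigroup using (x∙yz≈xz∙y; xy∙z≈xz∙y)
open import Data.Product using (∃-syntax; ∃₂; _×_; _,_; proj₁; proj₂)
open import Data.Sum using (inj₁; inj₂)
open import Data.Vec using (Vec; lookup)
open import Data.Vec.Properties using (lookup∘tabulate; tabulate∘lookup; tabulate-cong)
open import Data.Bool using (if_then_else_)
open import Function using (_∘_; id)
open import Function.Bundles using (mk⇔; Equivalence)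
open import Induction.WellFounded using (Acc; acc)
open import Relation.Nullary using (¬_; yes; no; Dec)
open import Relation.Nullary.Decidable using (⌊_⌋; _×-dec_)
open import Relation.Binary.PropositionalEquality using (_≡_; _≢_; refl; sym; trans; cong; subst; module ≡-Reasoning)

module _ {a} {A : Set a} where

  Unique-++⁻ : ∀ xs {ys : List A} → Unique (xs ++ ys) → Unique xs × Disjoint xs ys
  Unique-++⁻ []       _          = [] , λ ()
  Unique-++⁻ (x ∷ xs) (x∉ ∷ u) with Unique-++⁻ xs u
  ... | u-xs , disjoint = ++⁻ˡ xs x∉ ∷ u-xs , λ
    { (here refl , x∈ys) → All.lookup (++⁻ʳ xs x∉) x∈ys refl
    ; (there v∈xs , v∈ys) → disjoint (v∈xs , v∈ys) }

  unique-⊆⇒↭++ : ∀ {xs ys : List A} → Unique xs → xs ⊆ₗ ys → ∃[ zs ] ys ↭ xs ++ zs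
  unique-⊆⇒↭++ {[]}     {ys} []         _   = ys , ↭-refl
  unique-⊆⇒↭++ {x ∷ xs} (x∉xs ∷ u) xs⊆ys with as , bs , refl ← ∈-∃++ (xs⊆ys (here refl)) =
    let zs , p = unique-⊆⇒↭++ u xs⊆as++bs in zs , ↭-trans (shift x as bs) (↭-prep x p)
    where
    xs⊆as++bs : xs ⊆ₗ as ++ bs
    xs⊆as++bs y∈xs with ∈-resp-↭ (shift x as bs) (xs⊆ys (there y∈xs))
    ... | here refl = ⊥-elim (All.lookup x∉xs y∈xs refl)
    ... | there y∈  = y∈

  sum-map-mono-⊆ : ∀ (f : A → ℕ) {xs ys} → Unique xs → xs ⊆ₗ ys → sum (map f xs) ≤ sum (map f ys)
  sum-map-mono-⊆ f {xs} {ys} u xs⊆ys with unique-⊆⇒↭++ u xs⊆ys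
  ... | zs , p = begin
    sum (map f xs)                    ≤⟨ m≤m+n _ _ ⟩
    sum (map f xs) + sum (map f zs)   ≡⟨ sum-++ (map f xs) (map f zs) ⟨
    sum (map f xs ++ map f zs)        ≡⟨ cong sum (map-++ f xs zs) ⟨
    sum (map f (xs ++ zs))            ≡⟨ sum-↭ (map⁺ f p) ⟨
    sum (map f ys)                    ∎
    where open ≤-Reasoning

  length-mono-⊆ : ∀ {xs ys : List A} → Unique xs → xs ⊆ₗ ys → length xs ≤ length ys
  length-mono-⊆ {xs} u xs⊆ys with unique-⊆⇒↭++ u xs⊆ys
  ... | zs , p = ≤-trans (length-++-≤ˡ xs) (≤-reflexive (sym (↭-length p)))

  unique-⊆-antisym : ∀ {xs ys : List A} → Unique xs → Unique ys → xs ⊆ₗ ys → ys ⊆ₗ xs → xs ↭ ys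
  unique-⊆-antisym u-xs u-ys xs⊆ys ys⊆xs = ∼bag⇒↭ (unique∧set⇒bag u-xs u-ys (mk⇔ xs⊆ys ys⊆xs))

lookup-extensional : ∀ {a} {A : Set a} {m} (xs ys : Vec A m) → (∀ i → lookup xs i ≡ lookup ys i) → xs ≡ ys
lookup-extensional xs ys eq = trans (sym (tabulate∘lookup xs)) (trans (tabulate-cong eq) (tabulate∘lookup ys))

loss : ∀ {n} → Multigraph n → Vertex n → Vertex n → ℕ
loss G w v = if ⌊ w ≟ v ⌋ then outdeg G v else 0

canFire? : ∀ {n} (G : Multigraph n) σ v → Dec (CanFire G σ v)
canFire? G σ v = (1 ≤? outdeg G v) ×-dec (outdeg G v ≤? lookup σ v)

module _ {n} {G : Multigraph n} where

  ¬CanFire-sink : outdeg G sink ≡ 0 → ∀ σ → ¬ CanFire G σ sink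
  ¬CanFire-sink d⁺⊥≡0 _ (1≤d⁺⊥ , _) with () ← subst (1 ≤_) d⁺⊥≡0 1≤d⁺⊥

  exec-sink∉ : outdeg G sink ≡ 0 → ∀ {σ vs τ} → Exec G σ vs τ → sink ∉ vs
  exec-sink∉ d⁺⊥≡0 (step {σ} cf _) (here refl) = ¬CanFire-sink d⁺⊥≡0 σ cf
  exec-sink∉ d⁺⊥≡0 (step _ e)  (there ⊥∈) = exec-sink∉ d⁺⊥≡0 e ⊥∈

  lookup-fire : ∀ σ v w → lookup (fire G σ v) w ≡ (lookup σ w + G v w) ∸ loss G w v
  lookup-fire σ v w = lookup∘tabulate (λ w → (lookup σ w + G v w) ∸ loss G w v) w

  -- Fireability guarantees that the truncated subtraction in fire does not truncate.
  fire-balance : ∀ σ v → CanFire G σ v → ∀ w → lookup (fire G σ v) w + loss G w v ≡ lookup σ w + G v w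
  fire-balance σ v (_ , d⁺≤σv) w rewrite lookup-fire σ v w = m∸n+n≡m loss≤
    where
    loss≤ : loss G w v ≤ lookup σ w + G v w
    loss≤ with w ≟ v
    ... | yes refl = ≤-trans d⁺≤σv (m≤m+n _ _)
    ... | no _     = z≤n

  exec-balance : ∀ {σ vs τ} → Exec G σ vs τ → ∀ w →
                 lookup τ w + sum (map (loss G w) vs) ≡ lookup σ w + sum (map (λ v → G v w) vs)
  exec-balance done w = refl
  exec-balance {σ} {v ∷ vs} {τ} (step cf e) w = begin
    lookup τ w + (loss G w v + sum (map (loss G w) vs))          ≡⟨ x∙yz≈xz∙y (lookup τ w) _ _ ⟩
    (lookup τ w + sum (map (loss G w) vs)) + loss G w v          ≡⟨ cong (_+ loss G w v) (exec-balance e w) ⟩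
    (lookup σ′ w + sum (map (λ x → G x w) vs)) + loss G w v      ≡⟨ xy∙z≈xz∙y (lookup σ′ w) _ _ ⟩
    (lookup σ′ w + loss G w v) + sum (map (λ x → G x w) vs)      ≡⟨ cong (_+ sum (map (λ x → G x w) vs)) (fire-balance σ v cf w) ⟩
    (lookup σ w + G v w) + sum (map (λ x → G x w) vs)            ≡⟨ +-assoc (lookup σ w) _ _ ⟩
    lookup σ w + (G v w + sum (map (λ x → G x w) vs))            ∎
    where
    σ′ = fire G σ v
    open ≡-Reasoning

  exec-↭-config : ∀ {σ as bs τ τ′} → Exec G σ as τ → Exec G σ bs τ′ → as ↭ bs → τ ≡ τ′
  exec-↭-config {σ} {as} {bs} {τ} {τ′} e e′ as↭bs = lookup-extensional τ τ′ λ w → +-cancelʳ-≡ _ _ _ (begin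
    lookup τ w + sum (map (loss G w) as)           ≡⟨ exec-balance e w ⟩
    lookup σ w + sum (map (λ v → G v w) as)        ≡⟨ cong (lookup σ w +_) (sum-↭ (map⁺ (λ v → G v w) as↭bs)) ⟩
    lookup σ w + sum (map (λ v → G v w) bs)        ≡⟨ exec-balance e′ w ⟨
    lookup τ′ w + sum (map (loss G w) bs)          ≡⟨ cong (lookup τ′ w +_) (sum-↭ (map⁺ (loss G w) as↭bs)) ⟨
    lookup τ′ w + sum (map (loss G w) as)          ∎)
    where open ≡-Reasoning

  exec-deterministic : ∀ {σ vs τ τ′} → Exec G σ vs τ → Exec G σ vs τ′ → τ ≡ τ′
  exec-deterministic done        done         = refl
  exec-deterministic (step _ e)  (step _ e′)  = exec-deterministic e e′

  exec-++ : ∀ {σ as ρ bs τ} → Exec G σ as ρ → Exec G ρ bs τ → Exec G σ (as ++ bs) τ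
  exec-++ done         e₂ = e₂
  exec-++ (step cf e₁) e₂ = step cf (exec-++ e₁ e₂)

  fire-preserves-CanFire : ∀ σ {u v} → u ≢ v → CanFire G σ u → CanFire G (fire G σ v) u
  fire-preserves-CanFire σ {u} {v} u≢v (1≤d⁺ , d⁺≤σu) = 1≤d⁺ , ≤-trans d⁺≤σu σu≤
    where
    σu≤ : lookup σ u ≤ lookup (fire G σ v) u
    σu≤ rewrite lookup-fire σ v u with u ≟ v
    ... | yes u≡v = ⊥-elim (u≢v u≡v)
    ... | no _    = m≤m+n _ _

  fire-comm : ∀ σ {u v} → CanFire G σ u → CanFire G σ v → u ≢ v → fire G (fire G σ u) v ≡ fire G (fire G σ v) u
  fire-comm σ {u} {v} cu cv u≢v = exec-↭-config {σ}
    (step cu (step (fire-preserves-CanFire σ (u≢v ∘ sym) cv) done))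
    (step cv (step (fire-preserves-CanFire σ u≢v cu) done))
    (↭-swap u v ↭-refl)

  final-reachable-after-fire : ∀ {σ vs f u} → Exec G σ vs f → Final G f → CanFire G σ u → Reach G (fire G σ u) f
  final-reachable-after-fire done fin cu = ⊥-elim (fin _ cu)
  final-reachable-after-fire {σ} {f = f} {u} (step {v = v} cv e) fin cu with u ≟ v
  ... | yes refl = _ , e
  ... | no u≢v with final-reachable-after-fire e fin (fire-preserves-CanFire σ u≢v cu)
  ...   | us , e′ = v ∷ us , step (fire-preserves-CanFire σ (u≢v ∘ sym) cv)
                                  (subst (λ ρ → Exec G ρ us f) (sym (fire-comm σ cu cv u≢v)) e′)

  final-reachable-after : ∀ {σ us τ vs f} → Exec G σ us τ → Exec G σ vs f → Final G f → Reach G τ f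
  final-reachable-after done         e fin = _ , e
  final-reachable-after (step cu e₁) e fin = final-reachable-after e₁ (proj₂ (final-reachable-after-fire e fin cu)) fin

  sum-loss-unfired : ∀ {v vs} → v ∉ vs → sum (map (loss G v) vs) ≡ 0
  sum-loss-unfired {vs = []}     v∉ = refl
  sum-loss-unfired {v} {x ∷ vs} v∉ with v ≟ x
  ... | yes v≡x = ⊥-elim (v∉ (here v≡x))
  ... | no _    = sum-loss-unfired (v∉ ∘ there)

  chips-unfired : ∀ {σ vs τ v} → Exec G σ vs τ → v ∉ vs → lookup τ v ≡ lookup σ v + sum (map (λ x → G x v) vs)
  chips-unfired {σ} {vs} {τ} {v} e v∉ = begin
    lookup τ v                                ≡⟨ +-identityʳ _ ⟨
    lookup τ v + 0                            ≡⟨ cong (lookup τ v +_) (sum-loss-unfired v∉) ⟨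
    lookup τ v + sum (map (loss G v) vs)      ≡⟨ exec-balance e v ⟩
    lookup σ v + sum (map (λ x → G x v) vs)   ∎
    where open ≡-Reasoning

module Simple {n} (C : CFG n) (simple-C : IsSimpleCFG C) where

  open IsSimpleCFG simple-C
  open import Data.List.Membership.DecPropositional {A = Vertex n} _≟_ using (_∈?_)

  private
    G = graph C
    I = initial C

  extends-to-execution : ∀ {vs τ} → Exec G I vs τ → ∃₂ λ us f → Exec G τ us f × Final G f
  extends-to-execution e with convergent
  ... | f , (_ , e-f) , fin with final-reachable-after e e-f fin
  ...   | us , e′ = us , f , e′ , fin

  exec-unique : ∀ {vs τ} → Exec G I vs τ → Unique vs
  exec-unique {vs} e with extends-to-execution e
  ... | _ , _ , e′ , fin = proj₁ (Unique-++⁻ vs (simple _ _ (exec-++ e e′) fin))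

  fireable⇒unfired : ∀ {vs τ v} → Exec G I vs τ → CanFire G τ v → v ∉ vs
  fireable⇒unfired {vs} e cf v∈vs =
    proj₂ (Unique-++⁻ vs (exec-unique (exec-++ e (step cf done)))) (v∈vs , here refl)

  -- A vertex fired on the way to τ cannot fire again after τ, yet every
  -- non-sink vertex fires in an execution through τ.
  same-config⇒⊆ : ∀ {vs ws τ} → Exec G I vs τ → Exec G I ws τ → vs ⊆ₗ ws
  same-config⇒⊆ e₁ e₂ {zero} ⊥∈vs = ⊥-elim (exec-sink∉ sinkIsSink e₁ ⊥∈vs)
  same-config⇒⊆ {vs} {ws} e₁ e₂ {suc i} v∈vs with extends-to-execution e₁
  ... | _ , _ , e , fin with ∈-++⁻ ws (allFired _ _ (exec-++ e₂ e) fin i)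
  ...   | inj₁ v∈ws = v∈ws
  ...   | inj₂ v∈us = ⊥-elim (proj₂ (Unique-++⁻ vs (simple _ _ (exec-++ e₁ e) fin)) (v∈vs , v∈us))

  same-config⇒↭ : ∀ {vs ws τ} → Exec G I vs τ → Exec G I ws τ → vs ↭ ws
  same-config⇒↭ e₁ e₂ =
    unique-⊆-antisym (exec-unique e₁) (exec-unique e₂) (same-config⇒⊆ e₁ e₂) (same-config⇒⊆ e₂ e₁)

  -- Minimality ranges over all reachable configurations, so a minimal shot-set
  -- below vs cannot be computed; descending through strictly shorter shot
  -- sequences is well founded, which is enough to refute its absence.
  ¬¬InX-below : ∀ i {vs τ} → Exec G I vs τ → CanFire G τ (suc i) →
                ¬ ¬ (∃[ S ] InX C i S × S ⊆ (_∈ vs))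
  ¬¬InX-below i = descend (<-wellFounded _)
    where
    descend : ∀ {vs τ} → Acc _<_ (length vs) → Exec G I vs τ → CanFire G τ (suc i) →
              ¬ ¬ (∃[ S ] InX C i S × S ⊆ (_∈ vs))
    descend {vs} {τ} (acc shorter) e cf none =
      none ((_∈ vs) , ((τ , (vs , e , λ _ → mk⇔ id id) , cf) , minimal) , λ _ → id)
      where
      minimal : ∀ σ′ S′ → ShotSet C σ′ S′ → CanFire G σ′ (suc i) → S′ ⊆ (_∈ vs) → (_∈ vs) ⊆ S′
      minimal σ′ S′ (ws , e′ , ws≈S′) cf′ S′⊆vs with all? (_∈? ws) vs
      ... | yes vs⊆ws = λ v → Equivalence.to (ws≈S′ v) ∘ All.lookup vs⊆ws
      ... | no vs⊈ws with find (¬All⇒Any¬ (_∈? ws) vs vs⊈ws)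
      ...   | x , x∈vs , x∉ws = ⊥-elim (descend (shorter |ws|<|vs|) e′ cf′ λ (S , inX , S⊆ws) →
                                  none (S , inX , λ v → ws⊆vs ∘ S⊆ws v))
        where
        ws⊆vs : ws ⊆ₗ vs
        ws⊆vs {v} = S′⊆vs v ∘ Equivalence.to (ws≈S′ v)

        |ws|<|vs| : length ws < length vs
        |ws|<|vs| = length-mono-⊆ (¬Any⇒All¬ ws x∉ws ∷ exec-unique e′)
                      λ { (here refl) → x∈vs ; (there v∈ws) → ws⊆vs v∈ws }

  InX⇒CanFire-above : ∀ {i S vs τ} → InX C i S → S ⊆ (_∈ vs) → Exec G I vs τ → suc i ∉ vs →
                      CanFire G τ (suc i)
  InX⇒CanFire-above {i} {vs = vs} {τ} ((σ₀ , (ws , e₀ , ws≈S) , (1≤d⁺ , d⁺≤σ₀)) , _) S⊆vs e v∉vs =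
    1≤d⁺ , (begin
      outdeg G v                                 ≤⟨ d⁺≤σ₀ ⟩
      lookup σ₀ v                                ≡⟨ chips-unfired e₀ (v∉vs ∘ ws⊆vs) ⟩
      lookup I v + sum (map (λ x → G x v) ws)    ≤⟨ +-monoʳ-≤ (lookup I v) (sum-map-mono-⊆ (λ x → G x v) (exec-unique e₀) ws⊆vs) ⟩
      lookup I v + sum (map (λ x → G x v) vs)    ≡⟨ chips-unfired e v∉vs ⟨
      lookup τ v                                 ∎)
    where
    v = suc i
    open ≤-Reasoning

    ws⊆vs : ws ⊆ₗ vs
    ws⊆vs {x} = S⊆vs x ∘ Equivalence.to (ws≈S x)

module Transfer {n} (C C′ : CFG n) (simple-C : IsSimpleCFG C) (simple-C′ : IsSimpleCFG C′)
                (X⊆X′ : ∀ i S → InX C i S → InX C′ i S) where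

  private
    module S  = Simple C simple-C
    module S′ = Simple C′ simple-C′
    G  = graph C
    I  = initial C
    G′ = graph C′
    I′ = initial C′

  -- Fireability in C′ is decidable, so the double negation can be discharged.
  CanFire-transfer : ∀ {vs τ τ′ v} → Exec G I vs τ → Exec G′ I′ vs τ′ → CanFire G τ v → CanFire G′ τ′ v
  CanFire-transfer {τ = τ} {v = zero} _ _ cf = ⊥-elim (¬CanFire-sink {G = G} (IsSimpleCFG.sinkIsSink simple-C) τ cf)
  CanFire-transfer {τ′ = τ′} {v = suc i} e e′ cf with canFire? G′ τ′ (suc i)
  ... | yes cf′ = cf′
  ... | no ¬cf′ = ⊥-elim (S.¬¬InX-below i e cf λ (S , inX , S⊆vs) →
                    ¬cf′ (S′.InX⇒CanFire-above (X⊆X′ i S inX) S⊆vs e′ (S.fireable⇒unfired e cf)))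

  exec-transfer : ∀ {ps σ σ′ vs τ} → Exec G I ps σ → Exec G′ I′ ps σ′ → Exec G σ vs τ →
                  ∃[ τ′ ] Exec G′ σ′ vs τ′
  exec-transfer e e′ done = _ , done
  exec-transfer e e′ (step cf ex) =
    let cf′      = CanFire-transfer e e′ cf
        τ′ , ex′ = exec-transfer (exec-++ e (step cf done)) (exec-++ e′ (step cf′ done)) ex
    in τ′ , step cf′ ex′

  reach-transfer : ∀ {vs ws σ ρ σ′ ρ′} → Exec G I vs σ → Exec G I ws ρ →
                   Exec G′ I′ vs σ′ → Exec G′ I′ ws ρ′ → Reach G σ ρ → Reach G′ σ′ ρ′
  reach-transfer {σ′ = σ′} e₁ e₂ e₁′ e₂′ (us , ex) with exec-transfer e₁ e₁′ ex
  ... | τ′ , ex′ = us , subst (Exec G′ σ′ us)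
                          (exec-↭-config (exec-++ e₁′ ex′) e₂′ (S.same-config⇒↭ (exec-++ e₁ ex) e₂)) ex′

  image : ConfigSpace C → ConfigSpace C′
  image (_ , vs , e) = proj₁ (exec-transfer done done e) , vs , proj₂ (exec-transfer done done e)

  image-exec : ∀ {σ vs} (e : Exec G I vs σ) → Exec G′ I′ vs (proj₁ (image (σ , vs , e)))
  image-exec e = proj₂ (exec-transfer done done e)

proposition1 : ∀ {n} (C C' : CFG n) → IsSimpleCFG C → IsSimpleCFG C' →
    (∀ (i : Fin n) (S : VSet n) → (InX C i S → InX C' i S) × (InX C' i S → InX C i S)) →
    OrderIso C C'
proposition1 C C′ simple-C simple-C′ X≡X′ = record
  { to      = T.image
  ; from    = T′.image
  ; from∘to = λ (_ , _ , e) → exec-deterministic (T′.image-exec (T.image-exec e)) e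
  ; to∘from = λ (_ , _ , e) → exec-deterministic (T.image-exec (T′.image-exec e)) e
  ; mono    = λ (_ , _ , e₁) (_ , _ , e₂) → mk⇔
      (T.reach-transfer e₁ e₂ (T.image-exec e₁) (T.image-exec e₂))
      (T′.reach-transfer (T.image-exec e₁) (T.image-exec e₂) e₁ e₂)
  }
  where
  module T  = Transfer C C′ simple-C simple-C′ (λ i S → proj₁ (X≡X′ i S))
  module T′ = Transfer C′ C simple-C′ simple-C (λ i S → proj₂ (X≡X′ i S))
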